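{- Let $\mathcal{S}=\langle\mathcal{L},\vdash\rangle$ be a logic with $\mathcal{L}$ a formula algebra over a denumerable set of variables $V$. If $\mathrm{var}(\varphi)\neq\emptyset$ for all $\varphi\in\mathcal{L}$, then $\mathcal{S}^{pl}$ is NF-paraconsistent. Moreover, if in addition $\emptyset\not\vdash q$ for all $q\in V$, then $\mathcal{S}^{l}$ is also NF-paraconsistent.
   Context: A logic is a pair $\langle\mathcal{L},\vdash\rangle$ with $\vdash\,\subseteq\mathcal{P}(\mathcal{L})\times\mathcal{L}$, and $C_\vdash(\Gamma)=\{\alpha:\Gamma\vdash\alpha\}$. $\mathcal{L}$ is the set of formulas built inductively over a denumerable set $V$ of variables using a finite set of connectives. $\mathrm{var}(\alpha)$ is the set of variables occurring in $\alpha$, and $\mathrm{var}(\Delta)=\bigcup_{\alpha\in\Delta}\mathrm{var}(\alpha)$. $\mathcal{S}^l=\langle\mathcal{L},\vdash^l\rangle$ where $\Gamma\vdash^l\alpha$ iff there is $\Delta\subseteq\Gamma$ with $\mathrm{var}(\Delta)\subseteq\mathrm{var}(\alpha)$ and $\Delta\vdash\alpha$; $\mathcal{S}^{pl}=\langle\mathcal{L},\vdash^{pl}\rangle$ where $\Gamma\vdash^{pl}\alpha$ iff there is a nonempty $\Delta\subseteq\Gamma$ with $\mathrm{var}(\Delta)\subseteq\mathrm{var}(\alpha)$ and $\Delta\vdash\alpha$. A logic $\langle\mathcal{L},\vdash\rangle$ is NF-paraconsistent if there exists $\alpha\in\mathcal{L}$ such that $C_\vdash(\{\alpha,\beta\})\neq\mathcal{L}$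 for every $\beta\in\mathcal{L}$. -}

module Defs where

open import Level using (Level; 0ℓ; suc; _⊔_)
open import Data.Nat using (ℕ)
open import Data.Fin using (Fin)
open import Data.Product using (Σ; ∃; _×_; _,_)
open import Data.Sum using (_⊎_)
open import Data.Empty using (⊥)
open import Relation.Nullary using (¬_)
open import Relation.Binary.PropositionalEquality using (_≡_)

record Signature : Set where
  field
    k     : ℕ
    arity : Fin k → ℕ
open Signature public

data Form (Σs : Signature) : Set where
  var : ℕ → Form Σs
  op  : (c : Fin (k Σs)) → (Fin (arity Σs c) → Form Σs) → Form Σs

module _ {Σs : Signature} where

  data _∈var_ (x : ℕ) : Form Σs → Set where
    here  : x ∈var var x
    there : ∀ {c args} (i : Fin (arity Σs c)) → x ∈var args i → x ∈var op c args

  FSet : Set₁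
  FSet = Form Σs → Set

  _⊆_ : FSet → FSet → Set
  Δ ⊆ Γ = ∀ φ → Δ φ → Γ φ

  _≐_ : FSet → FSet → Set
  Δ ≐ Γ = (Δ ⊆ Γ) × (Γ ⊆ Δ)

  ∅ : FSet
  ∅ _ = ⊥

  pair : Form Σs → Form Σs → FSet
  pair α β φ = (φ ≡ α) ⊎ (φ ≡ β)

  _∈varSet_ : ℕ → FSet → Set
  x ∈varSet Δ = ∃ λ δ → Δ δ × (x ∈var δ)

  varSub : FSet → Form Σs → Set
  varSub Δ α = ∀ x → x ∈varSet Δ → x ∈var α

  Nonempty : FSet → Set
  Nonempty Δ = ∃ λ δ → Δ δ

  Cons : (ℓ : Level) → Set (suc ℓ ⊔ suc 0ℓ)
  Cons ℓ = FSet → Form Σs → Set ℓ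

  NFParaconsistent : ∀ {ℓ} → Cons ℓ → Set ℓ
  NFParaconsistent _⊢_ = ∃ λ α → ∀ β → ¬ (∀ γ → pair α β ⊢ γ)

-- A logic over the formula algebra.  Since subsets of 𝓛 are represented
-- by predicates, we require ⊢ to respect extensional equality of sets.
record Logic (Σs : Signature) : Set₁ where
  field
    _⊢_  : FSet {Σs} → Form Σs → Set
    resp : ∀ {Γ Γ' α} → Γ ≐ Γ' → Γ ⊢ α → Γ' ⊢ α
open Logic public

module _ {Σs : Signature} (S : Logic Σs) where

  ⊢l : Cons {Σs} (suc 0ℓ)
  ⊢l Γ α = Σ (FSet {Σs}) λ Δ → (Δ ⊆ Γ) × varSub Δ α × _⊢_ S Δ α

  ⊢pl : Cons {Σs} (suc 0ℓ)
  ⊢pl Γ α = Σ (FSet {Σs}) λ Δ → Nonempty Δ × (Δ ⊆ Γ) × varSub Δ α × _⊢_ S Δ α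

-- Given α and β, pick a variable q occurring in neither.  A set Δ ⊆ {α, β}
-- with var(Δ) ⊆ var(q) = {q} can then contain no formula at all, since every
-- formula has a variable.  So {α, β} ⊢pl q fails outright, and {α, β} ⊢l q
-- would force ∅ ⊢ q.
module Submission where

open import Defs
open import Data.Nat using (ℕ; zero; suc; _≤_; _<_; _⊔_; s≤s)
open import Data.Nat.Properties using (≤-refl; ≤-trans; m≤m⊔n; m≤n⊔m; <⇒≱)
open import Data.Fin using (Fin; zero; suc)
open import Data.Product using (_×_; _,_)
open import Data.Sum using (inj₁; inj₂)
open import Function using (_∘_)
open import Relation.Nullary using (¬_)
open import Relation.Binary.PropositionalEquality using (_≡_; refl; subst)

maxᶠ : (n : ℕ) → (Fin n → ℕ) → ℕ
maxᶠ zero    f = 0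
maxᶠ (suc n) f = f zero ⊔ maxᶠ n (f ∘ suc)

≤-maxᶠ : ∀ n (f : Fin n → ℕ) i → f i ≤ maxᶠ n f
≤-maxᶠ (suc n) f zero    = m≤m⊔n _ _
≤-maxᶠ (suc n) f (suc i) = ≤-trans (≤-maxᶠ n (f ∘ suc) i) (m≤n⊔m _ _)

module _ {Σs : Signature} where

  maxVar : Form Σs → ℕ
  maxVar (var n)     = n
  maxVar (op c args) = maxᶠ (arity Σs c) (maxVar ∘ args)

  ∈var⇒≤maxVar : ∀ {x} (φ : Form Σs) → x ∈var φ → x ≤ maxVar φ
  ∈var⇒≤maxVar (var n)     here        = ≤-refl
  ∈var⇒≤maxVar (op c args) (there i p) =
    ≤-trans (∈var⇒≤maxVar (args i) p) (≤-maxᶠ _ (maxVar ∘ args) i)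

  >maxVar⇒∉var : ∀ {x} (φ : Form Σs) → maxVar φ < x → ¬ x ∈var φ
  >maxVar⇒∉var φ φ<x x∈φ = <⇒≱ φ<x (∈var⇒≤maxVar φ x∈φ)

  ∈var-var⇒≡ : ∀ {x q} → x ∈var var {Σs} q → x ≡ q
  ∈var-var⇒≡ here = refl

  freshVar : Form Σs → Form Σs → ℕ
  freshVar α β = suc (maxVar α ⊔ maxVar β)

  freshVar-∉pair : ∀ α β γ → pair α β γ → ¬ freshVar α β ∈var γ
  freshVar-∉pair α β γ (inj₁ refl) = >maxVar⇒∉var α (s≤s (m≤m⊔n _ _))
  freshVar-∉pair α β γ (inj₂ refl) = >maxVar⇒∉var β (s≤s (m≤n⊔m _ _))

  EveryFormulaHasVar : Set
  EveryFormulaHasVar = ∀ (φ : Form Σs) → ¬ (∀ (x : ℕ) → ¬ (x ∈var φ))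

  varSub-var-avoiding⇒empty : EveryFormulaHasVar →
    ∀ {Γ Δ : FSet} {q} → (∀ γ → Γ γ → ¬ q ∈var γ) →
    Δ ⊆ Γ → varSub Δ (var q) → ∀ δ → ¬ Δ δ
  varSub-var-avoiding⇒empty hasVar q∉Γ Δ⊆Γ Δ⊑q δ δ∈Δ = hasVar δ λ x x∈δ →
    q∉Γ δ (Δ⊆Γ δ δ∈Δ) (subst (_∈var δ) (∈var-var⇒≡ (Δ⊑q x (δ , δ∈Δ , x∈δ))) x∈δ)

module _ {Σs : Signature} (S : Logic Σs) (hasVar : EveryFormulaHasVar {Σs}) where

  ⊢pl-pair-nonexplosive : ∀ α β → ¬ (∀ γ → ⊢pl S (pair α β) γ)
  ⊢pl-pair-nonexplosive α β explodes
    with explodes (var (freshVar α β))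
  ... | Δ , (δ , δ∈Δ) , Δ⊆αβ , Δ⊑q , _ =
    varSub-var-avoiding⇒empty hasVar (freshVar-∉pair α β) Δ⊆αβ Δ⊑q δ δ∈Δ

  ⊢l-pair-nonexplosive : (∀ q → ¬ _⊢_ S ∅ (var q)) →
    ∀ α β → ¬ (∀ γ → ⊢l S (pair α β) γ)
  ⊢l-pair-nonexplosive ∅⊬q α β explodes
    with explodes (var (freshVar α β))
  ... | Δ , Δ⊆αβ , Δ⊑q , Δ⊢q = ∅⊬q (freshVar α β) (resp S (Δ⊆∅ , λ _ ()) Δ⊢q)
    where
    Δ⊆∅ : Δ ⊆ ∅
    Δ⊆∅ = varSub-var-avoiding⇒empty hasVar (freshVar-∉pair α β) Δ⊆αβ Δ⊑q

theorem2p17 : (Σs : Signature) (S : Logic Σs) →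
    (∀ (φ : Form Σs) → ¬ (∀ (x : ℕ) → ¬ (x ∈var φ))) →
    NFParaconsistent (⊢pl S)
      × ((∀ (q : ℕ) → ¬ (_⊢_ S ∅ (var q))) → NFParaconsistent (⊢l S))
theorem2p17 Σs S hasVar =
    (var 0 , ⊢pl-pair-nonexplosive S hasVar (var 0))
  , λ ∅⊬q → var 0 , ⊢l-pair-nonexplosive S hasVar ∅⊬q (var 0)
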